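{- Let $n\ge 1$ and let $\pi$ be a non-crossing partition of $[n]$. For $j\in[n]$, define $t=t(j)\in[n]$ as follows. Let $j-1$ be read modulo $n$, so that $j-1:=n$ when $j=1$. - If $j-1$ lies in the same block of $\pi$ as $j$, set $t:=j$. - Otherwise, let $\{b_1<b_2<\dots<b_s\}$ be the block of $\pi$ containing $j-1$, and let $j-1=b_k$. Set $t:=b_{k+1}$ if $k<s$, and $t:=b_1$ if $k=s$ (in particular $t=b_1$ if $s=1$). Then $j$ and $t$ belong to the same block of the Kreweras image $\rho(\pi)$.
   Context: A non-crossing partition of $[n]=\{1,\dots,n\}$ is a set partition of $[n]$ with no $i<j<k<l$ such that $i,k$ lie in one block and $j,l$ lie in a different block. Kreweras endomorphism $\rho$: place $2n$ points on a circle in clockwise cyclic order $1',1,2',2,\dots,n',n$, so that the primed point $i'$ lies between $i-1$ and $i$, and $1'$ lies between $n$ and $1$. Draw each block of $\pi$ as the polygon, or chord, on its unprimed points. These are non-crossing and cut the disk into regions. Then $\rho(\pi)$ is the partition of $[n]$ in which $i$ and $j$ are in the same block if and only if the points $i'$ and $j'$ lie in the same region. Equivalently, $\rho(\pi)$ is the coarsest partition of the primed points whose union with $\pi$ is non-crossing on the circle. -}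

module Defs where

open import Data.Nat using (ℕ; zero; suc; _+_; _*_; _<_)
open import Data.Fin using (Fin; toℕ; fromℕ; inject₁)
open import Data.Sum using (_⊎_; inj₁; inj₂)
open import Data.Product using (_×_)
open import Data.Empty using (⊥)
open import Relation.Nullary using (¬_)
open import Relation.Binary.PropositionalEquality using (_≡_; _≢_)

-- A set partition of [n] (here [n] = Fin n, element i ↦ i+1) is given by a
-- block-labelling: i and j lie in the same block iff their labels agree.
Partition : ℕ → Set
Partition n = Fin n → ℕ

SameBlock : ∀ {n} → Partition n → Fin n → Fin n → Set
SameBlock π i j = π i ≡ π j

_<ᶠ_ : ∀ {n} → Fin n → Fin n → Set
i <ᶠ j = toℕ i < toℕ j

NonCrossing : ∀ {n} → Partition n → Set
NonCrossing π = ∀ i j k l → i <ᶠ j → j <ᶠ k → k <ᶠ l →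
  SameBlock π i k → SameBlock π j l → SameBlock π i j

-- The 2n points on the circle: inj₁ i is the unprimed point i, inj₂ i is the
-- primed point i'.  Clockwise order 1',1,2',2,...,n',n (cut at 1').
Pt : ℕ → Set
Pt n = Fin n ⊎ Fin n

pos : ∀ {n} → Pt n → ℕ
pos (inj₁ i) = suc (2 * toℕ i)
pos (inj₂ i) = 2 * toℕ i

Joint : ∀ {n} → Partition n → Partition n → Pt n → Pt n → Set
Joint π σ (inj₁ i) (inj₁ j) = SameBlock π i j
Joint π σ (inj₂ i) (inj₂ j) = SameBlock σ i j
Joint π σ (inj₁ i) (inj₂ j) = ⊥
Joint π σ (inj₂ i) (inj₁ j) = ⊥

UnionNonCrossing : ∀ {n} → Partition n → Partition n → Set
UnionNonCrossing π σ = ∀ a b c d → pos a < pos b → pos b < pos c → pos c < pos d →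
  Joint π σ a c → Joint π σ b d → Joint π σ a b

IsKreweras : ∀ {n} → Partition n → Partition n → Set
IsKreweras {n} π σ = UnionNonCrossing π σ ×
  (∀ (σ′ : Partition n) → UnionNonCrossing π σ′ →
     ∀ i j → SameBlock σ′ i j → SameBlock σ i j)

prev : ∀ {m} → Fin (suc m) → Fin (suc m)
prev {m} Fin.zero = fromℕ m
prev (Fin.suc i) = inject₁ i

CyclicNext : ∀ {n} → Partition n → Fin n → Fin n → Set
CyclicNext π b t = SameBlock π b t ×
  ((b <ᶠ t × (∀ u → SameBlock π b u → b <ᶠ u → ¬ (u <ᶠ t)))
   ⊎
   ((∀ u → SameBlock π b u → ¬ (b <ᶠ u)) × (∀ u → SameBlock π b u → ¬ (u <ᶠ t))))

IsT : ∀ {m} → Partition (suc m) → Fin (suc m) → Fin (suc m) → Set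
IsT π j t =
  (SameBlock π (prev j) j × t ≡ j)
  ⊎
  (¬ SameBlock π (prev j) j × CyclicNext π (prev j) t)

{-# OPTIONS --safe #-}
-- The region of the Kreweras picture containing j′ is bounded by the edge of
-- π joining j − 1 to its cyclic successor t in its block, and t′ lies just
-- before t, so j′ and t′ lie in the same region: the chord j′t′ crosses no
-- block of π. Hence the partition of the primed points whose only
-- non-singleton block is {j′, t′} is non-crossing together with π, and
-- coarsestness of ρ(π) puts j and t in one block.
module Submission where

open import Defs
open import Data.Nat using (ℕ; suc; _≤_; _<_; z≤n; s≤s; s≤s⁻¹)
open import Data.Nat.Properties
  using (≤-refl; ≤-trans; <⇒≤; <⇒≱; ≮⇒≥; ≰⇒>; <-irrefl; <-asym; m≤n⇒m≤1+n; m≤n⇒m<n∨m≡n;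
         *-cancelˡ-<; *-cancelˡ-≤)
open import Data.Fin using (Fin; zero; suc; toℕ; _≟_) renaming (_≤_ to _≤ᶠ_)
open import Data.Fin.Properties using (toℕ-injective; toℕ-fromℕ; toℕ-inject₁; toℕ<n)
open import Data.Sum using (_⊎_; inj₁; inj₂)
import Data.Sum as Sum
open import Data.Product using (_×_; _,_; proj₁; proj₂)
open import Data.Empty using (⊥-elim)
open import Relation.Nullary using (¬_; yes; no)
open import Relation.Binary.PropositionalEquality using (_≡_; refl; sym; trans; subst)

private variable
  n : ℕ
  π σ : Partition n
  a b c d j p t x y : Fin n
  lo hi : ℕ

≤ᶠ⇒<ᶠ⊎≡ : a ≤ᶠ b → a <ᶠ b ⊎ a ≡ b
≤ᶠ⇒<ᶠ⊎≡ a≤b = Sum.map₂ toℕ-injective (m≤n⇒m<n∨m≡n a≤b)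

pos<⇒<₁₁ : pos (inj₁ a) < pos (inj₁ b) → a <ᶠ b
pos<⇒<₁₁ {a = a} {b} h = *-cancelˡ-< 2 (toℕ a) (toℕ b) (s≤s⁻¹ h)

pos<⇒<₁₂ : pos (inj₁ a) < pos (inj₂ b) → a <ᶠ b
pos<⇒<₁₂ {a = a} {b} h = *-cancelˡ-< 2 (toℕ a) (toℕ b) (<⇒≤ h)

pos<⇒≤₂₁ : pos (inj₂ a) < pos (inj₁ b) → a ≤ᶠ b
pos<⇒≤₂₁ h = *-cancelˡ-≤ 2 (s≤s⁻¹ h)

pos<⇒<₂₂ : pos (inj₂ a) < pos (inj₂ b) → a <ᶠ b
pos<⇒<₂₂ {a = a} {b} h = *-cancelˡ-< 2 (toℕ a) (toℕ b) h

InRange : ℕ → ℕ → Fin n → Set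
InRange lo hi x = lo ≤ toℕ x × toℕ x < hi

BlockClosed : Partition n → ℕ → ℕ → Set
BlockClosed π lo hi = ∀ {x y} → SameBlock π x y → InRange lo hi x → InRange lo hi y

-- For J, T ≤ n the chord J′T′ (with n′ = 0′) has the unprimed points of
-- [J, T) or of [T, J) on one side, the other interval being empty.
ChordFree : Partition n → ℕ → ℕ → Set
ChordFree π J T = BlockClosed π J T × BlockClosed π T J

emptyRange-blockClosed : hi ≤ lo → BlockClosed π lo hi
emptyRange-blockClosed hi≤lo _ (lo≤x , x<hi) = ⊥-elim (<⇒≱ x<hi (≤-trans hi≤lo lo≤x))

chordFree-wrap : {π : Partition n} {T : ℕ} → ChordFree π n T → ChordFree π 0 T
chordFree-wrap {π = π} {T} (_ , closed) = complement , emptyRange-blockClosed z≤n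
  where
  complement : BlockClosed π 0 T
  complement {x} {y} xy (_ , x<T) =
    z≤n , ≰⇒> (λ T≤y → <⇒≱ x<T (proj₁ (closed (sym xy) (T≤y , toℕ<n y))))

crossing⇒sameBlock : NonCrossing π → SameBlock π a b → a ≤ᶠ x → x ≤ᶠ b →
  SameBlock π x y → toℕ y ≤ toℕ a ⊎ toℕ b ≤ toℕ y → SameBlock π a x
crossing⇒sameBlock {π = π} {a} {b} {x} {y} nc ab a≤x x≤b xy out
  with ≤ᶠ⇒<ᶠ⊎≡ a≤x | ≤ᶠ⇒<ᶠ⊎≡ x≤b
... | inj₂ refl | _ = refl
... | inj₁ _ | inj₂ refl = ab
... | inj₁ a<x | inj₁ x<b = escape out
  where
  escape : toℕ y ≤ toℕ a ⊎ toℕ b ≤ toℕ y → SameBlock π a x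
  escape (inj₁ y≤a) with ≤ᶠ⇒<ᶠ⊎≡ y≤a
  ... | inj₁ y<a = trans (sym (nc y a x b y<a a<x x<b (sym xy) ab)) (sym xy)
  ... | inj₂ refl = sym xy
  escape (inj₂ b≤y) with ≤ᶠ⇒<ᶠ⊎≡ b≤y
  ... | inj₁ b<y = nc a x b y a<x x<b b<y ab xy
  ... | inj₂ refl = trans ab (sym xy)

gap-blockClosed : NonCrossing π → SameBlock π p t →
  (∀ u → SameBlock π p u → p <ᶠ u → ¬ u <ᶠ t) → BlockClosed π (suc (toℕ p)) (toℕ t)
gap-blockClosed {π = π} {p} {t} nc pt gap {x} {y} xy (p<x , x<t) =
  ≰⇒> (λ y≤p → escape (inj₁ y≤p)) , ≰⇒> (λ t≤y → escape (inj₂ t≤y))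
  where
  escape : ¬ (toℕ y ≤ toℕ p ⊎ toℕ t ≤ toℕ y)
  escape out = gap x (crossing⇒sameBlock nc pt (<⇒≤ p<x) (<⇒≤ x<t) xy out) p<x x<t

span-blockClosed : NonCrossing π → SameBlock π p t →
  (∀ u → SameBlock π p u → ¬ p <ᶠ u) → (∀ u → SameBlock π p u → ¬ u <ᶠ t) →
  BlockClosed π (toℕ t) (suc (toℕ p))
span-blockClosed {π = π} {p} {t} nc pt top bottom {x} {y} xy (t≤x , x≤p) =
  ≮⇒≥ (λ y<t → bottom y (inBlock (inj₁ (<⇒≤ y<t))) y<t) ,
  s≤s (≮⇒≥ (λ p<y → top y (inBlock (inj₂ (<⇒≤ p<y))) p<y))
  where
  inBlock : toℕ y ≤ toℕ t ⊎ toℕ p ≤ toℕ y → SameBlock π p y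
  inBlock out = trans pt (trans (crossing⇒sameBlock nc (sym pt) t≤x (s≤s⁻¹ x≤p) xy out) xy)

cyclicNext-chordFree : NonCrossing π → CyclicNext π p t → ChordFree π (suc (toℕ p)) (toℕ t)
cyclicNext-chordFree nc (pt , inj₁ (p<t , gap)) =
  gap-blockClosed nc pt gap , emptyRange-blockClosed p<t
cyclicNext-chordFree {t = t} nc (pt , inj₂ (top , bottom)) =
  emptyRange-blockClosed (m≤n⇒m≤1+n (≮⇒≥ (top t pt))) , span-blockClosed nc pt top bottom

-- j′ is the primed point just after prev j, read as n′ = 0′ when j = 0.
prev-cyclicNext-chordFree : ∀ {m} {π : Partition (suc m)} {t} → NonCrossing π →
  (j : Fin (suc m)) → CyclicNext π (prev j) t → ChordFree π (toℕ j) (toℕ t)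
prev-cyclicNext-chordFree {m} {π} {t} nc zero next =
  chordFree-wrap
    (subst (λ k → ChordFree π (suc k) (toℕ t)) (toℕ-fromℕ m) (cyclicNext-chordFree nc next))
prev-cyclicNext-chordFree {π = π} {t} nc (suc i) next =
  subst (λ k → ChordFree π (suc k) (toℕ t)) (toℕ-inject₁ i) (cyclicNext-chordFree nc next)

unionNonCrossing : NonCrossing π → NonCrossing σ →
  (∀ {b d} → SameBlock σ b d → BlockClosed π (toℕ b) (toℕ d)) → UnionNonCrossing π σ
unionNonCrossing ncπ _ _ (inj₁ a) (inj₁ b) (inj₁ c) (inj₁ d) ab bc cd =
  ncπ a b c d (pos<⇒<₁₁ ab) (pos<⇒<₁₁ bc) (pos<⇒<₁₁ cd)
unionNonCrossing _ ncσ _ (inj₂ a) (inj₂ b) (inj₂ c) (inj₂ d) ab bc cd =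
  ncσ a b c d (pos<⇒<₂₂ ab) (pos<⇒<₂₂ bc) (pos<⇒<₂₂ cd)
unionNonCrossing _ _ chords (inj₁ a) (inj₂ b) (inj₁ c) (inj₂ d) ab bc cd ac bd =
  <⇒≱ (pos<⇒<₁₂ ab) (proj₁ (chords bd (sym ac) (pos<⇒≤₂₁ bc , pos<⇒<₁₂ cd)))
unionNonCrossing _ _ chords (inj₂ a) (inj₁ b) (inj₂ c) (inj₁ d) ab bc cd ac bd =
  <⇒≱ (proj₂ (chords ac bd (pos<⇒≤₂₁ ab , pos<⇒<₁₂ bc))) (pos<⇒≤₂₁ cd)
unionNonCrossing _ _ _ (inj₁ _) _ (inj₂ _) _ _ _ _ ()
unionNonCrossing _ _ _ (inj₂ _) _ (inj₁ _) _ _ _ _ ()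
unionNonCrossing _ _ _ _ (inj₁ _) _ (inj₂ _) _ _ _ _ ()
unionNonCrossing _ _ _ _ (inj₂ _) _ (inj₁ _) _ _ _ _ ()

pairPartition : Fin n → Fin n → Partition n
pairPartition j t a with a ≟ t
... | yes _ = toℕ j
... | no _ = toℕ a

pairPartition-joins : (j t : Fin n) → SameBlock (pairPartition j t) j t
pairPartition-joins j t with j ≟ t | t ≟ t
... | _ | no t≢t = ⊥-elim (t≢t refl)
... | yes _ | yes _ = refl
... | no _ | yes _ = refl

pairPartition-sameBlock : SameBlock (pairPartition j t) a c →
  a ≡ c ⊎ (a ≡ j × c ≡ t) ⊎ (a ≡ t × c ≡ j)
pairPartition-sameBlock {t = t} {a} {c} e with a ≟ t | c ≟ t
... | yes refl | yes refl = inj₁ refl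
... | yes refl | no _ = inj₂ (inj₂ (refl , sym (toℕ-injective e)))
... | no _ | yes refl = inj₂ (inj₁ (toℕ-injective e , refl))
... | no _ | no _ = inj₁ (toℕ-injective e)

pairPartition-nonCrossing : (j t : Fin n) → NonCrossing (pairPartition j t)
pairPartition-nonCrossing j t a b c d a<b b<c c<d ac bd
  with pairPartition-sameBlock {j = j} {t} {a} {c} ac
     | pairPartition-sameBlock {j = j} {t} {b} {d} bd
... | inj₁ refl | _ = ⊥-elim (<-asym a<b b<c)
... | _ | inj₁ refl = ⊥-elim (<-asym b<c c<d)
... | inj₂ (inj₁ (refl , refl)) | inj₂ (inj₁ (refl , refl)) = ⊥-elim (<-irrefl refl a<b)
... | inj₂ (inj₁ (refl , refl)) | inj₂ (inj₂ (refl , refl)) = ⊥-elim (<-irrefl refl b<c)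
... | inj₂ (inj₂ (refl , refl)) | inj₂ (inj₁ (refl , refl)) = ⊥-elim (<-irrefl refl b<c)
... | inj₂ (inj₂ (refl , refl)) | inj₂ (inj₂ (refl , refl)) = ⊥-elim (<-irrefl refl a<b)

pairPartition-chords : ChordFree π (toℕ j) (toℕ t) →
  SameBlock (pairPartition j t) b d → BlockClosed π (toℕ b) (toℕ d)
pairPartition-chords {j = j} {t} {b} {d} free bd
  with pairPartition-sameBlock {j = j} {t} {b} {d} bd
... | inj₁ refl = emptyRange-blockClosed ≤-refl
... | inj₂ (inj₁ (refl , refl)) = proj₁ free
... | inj₂ (inj₂ (refl , refl)) = proj₂ free

mainTheorem2 : (m : ℕ) (π σ : Partition (suc m)) → NonCrossing π → IsKreweras π σ →
    (j t : Fin (suc m)) → IsT π j t → SameBlock σ j t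
mainTheorem2 _ _ _ _ _ _ _ (inj₁ (_ , refl)) = refl
mainTheorem2 _ π _ nc (_ , coarsest) j t (inj₂ (_ , next)) =
  coarsest (pairPartition j t) union j t (pairPartition-joins j t)
  where
  union : UnionNonCrossing π (pairPartition j t)
  union = unionNonCrossing nc (pairPartition-nonCrossing j t)
    (pairPartition-chords (prev-cyclicNext-chordFree nc j next))
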